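{- Let $P_k$ denote the path with $k$ vertices and $C_4$ the cycle with $4$ vertices. For every $t\geq 1$, $\chi_{D_L}(P_{2t})=2$, $\chi_{D_L}(P_{2t+1})=3$, and $\chi_{D_L}(C_4)=4$.
   Context: A vertex coloring $f$ of a graph $G$ is distinguishing if the only automorphism $\phi$ of $G$ with $f(\phi(v))=f(v)$ for all vertices $v$ is the identity. A list assignment $L=\{L(v)\}_{v\in V(G)}$ assigns to each vertex a finite set of colors; $G$ is properly $L$-distinguishable if there is a proper vertex coloring $f$ of $G$ which is distinguishing and satisfies $f(v)\in L(v)$ for all $v$. The list-distinguishing chromatic number $\chi_{D_L}(G)$ is the minimum integer $k$ such that $G$ is properly $L$-distinguishable for every list assignment $L$ with $|L(v)|=k$ for all $v\in V(G)$. -}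

module Defs where

open import Data.Nat using (ℕ; zero; suc; _<_; _∸_)
open import Data.Fin using (Fin; toℕ)
open import Data.Fin.Permutation using (Permutation′; _⟨$⟩ʳ_)
open import Data.List using (List; length)
open import Data.List.Membership.Propositional using (_∈_)
open import Data.List.Relation.Unary.Unique.Propositional using (Unique)
open import Data.Product using (Σ; _×_)
open import Data.Sum using (_⊎_)
open import Relation.Binary.PropositionalEquality using (_≡_; _≢_; sym; trans)
open import Data.Sum using (inj₁; inj₂)
open import Data.Product using (_,_)
open import Data.Nat.Properties using (1+n≢n)
open import Relation.Nullary using (¬_)
open import Function.Bundles using (_⇔_)

record Graph (n : ℕ) : Set₁ where
  field
    Adj   : Fin n → Fin n → Set
    adj-sym : ∀ {u v} → Adj u v → Adj v u
    adj-irrefl : ∀ {u} → ¬ Adj u u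
open Graph public

Color : Set
Color = ℕ

Coloring : ℕ → Set
Coloring n = Fin n → Color

IsAutomorphism : ∀ {n} → Graph n → Permutation′ n → Set
IsAutomorphism G φ = ∀ u v → Adj G u v ⇔ Adj G (φ ⟨$⟩ʳ u) (φ ⟨$⟩ʳ v)

Distinguishing : ∀ {n} → Graph n → Coloring n → Set
Distinguishing {n} G f =
  (φ : Permutation′ n) → IsAutomorphism G φ →
  (∀ v → f (φ ⟨$⟩ʳ v) ≡ f v) → ∀ v → φ ⟨$⟩ʳ v ≡ v

Proper : ∀ {n} → Graph n → Coloring n → Set
Proper G f = ∀ u v → Adj G u v → f u ≢ f v

ListAssignment : ℕ → Set
ListAssignment n = Fin n → List Color

HasListSize : ∀ {n} → ListAssignment n → ℕ → Set
HasListSize L k = ∀ v → Unique (L v) × length (L v) ≡ k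

ProperlyLDistinguishable : ∀ {n} → Graph n → ListAssignment n → Set
ProperlyLDistinguishable {n} G L =
  Σ (Coloring n) λ f → Proper G f × Distinguishing G f × (∀ v → f v ∈ L v)

ListDistChoosable : ∀ {n} → Graph n → ℕ → Set
ListDistChoosable {n} G k =
  (L : ListAssignment n) → HasListSize L k → ProperlyLDistinguishable G L

χDL≡ : ∀ {n} → Graph n → ℕ → Set
χDL≡ G k = ListDistChoosable G k × (∀ j → j < k → ¬ ListDistChoosable G j)

PathAdj : ∀ {n} → Fin n → Fin n → Set
PathAdj i j = toℕ j ≡ suc (toℕ i) ⊎ toℕ i ≡ suc (toℕ j)

CycleAdj : ∀ n → Fin n → Fin n → Set
CycleAdj n i j = PathAdj i j
  ⊎ ((toℕ i ≡ 0 × toℕ j ≡ n ∸ 1) ⊎ (toℕ j ≡ 0 × toℕ i ≡ n ∸ 1))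

PathAdj-sym : ∀ {n} {i j : Fin n} → PathAdj i j → PathAdj j i
PathAdj-sym (inj₁ p) = inj₂ p
PathAdj-sym (inj₂ p) = inj₁ p

PathAdj-irrefl : ∀ {n} {i : Fin n} → ¬ PathAdj i i
PathAdj-irrefl {i = i} (inj₁ p) = 1+n≢n (sym p)
PathAdj-irrefl {i = i} (inj₂ p) = 1+n≢n (sym p)

P : (k : ℕ) → Graph k
P k = record { Adj = PathAdj ; adj-sym = PathAdj-sym ; adj-irrefl = PathAdj-irrefl }

CycleAdj-sym : ∀ {n} {i j : Fin n} → CycleAdj n i j → CycleAdj n j i
CycleAdj-sym (inj₁ p) = inj₁ (PathAdj-sym p)
CycleAdj-sym (inj₂ (inj₁ p)) = inj₂ (inj₂ p)
CycleAdj-sym (inj₂ (inj₂ p)) = inj₂ (inj₁ p)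

C4-irrefl : {i : Fin 4} → ¬ CycleAdj 4 i i
C4-irrefl (inj₁ p) = PathAdj-irrefl p
C4-irrefl (inj₂ (inj₁ (a , b))) with trans (sym a) b
... | ()
C4-irrefl (inj₂ (inj₂ (a , b))) with trans (sym a) b
... | ()

C4 : Graph 4
C4 = record { Adj = CycleAdj 4 ; adj-sym = CycleAdj-sym ; adj-irrefl = C4-irrefl }

{-# OPTIONS --safe #-}
-- Lower bounds: taking every list to be {0, …, k-1} turns list-distinguishability into an
-- ordinary proper distinguishing colouring with k colours. Two colours do not suffice on
-- P_{2t+1}: a proper 2-colouring of a path is determined by its colour at one vertex, so it
-- agrees with its mirror image, which has the same colour at the fixed centre; hence the
-- reversal preserves it. Three colours do not suffice on C4: some antipodal pair shares a
-- colour, and the reflection swapping that pair preserves the colouring.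
--
-- Upper bounds: the automorphisms of a path are the identity and the reversal, so a proper
-- colouring is distinguishing unless it is a palindrome. On P_{2t} the middle edge joins a
-- vertex to its mirror image, so no proper colouring is a palindrome and greedy 2-list
-- colouring works. With 3-lists, colour a path greedily from vertex 1 on and give vertex 0 a
-- colour differing from both vertex 1 and the last vertex. On C4, 4-lists allow an injective
-- colouring.

module Submission where

open import Defs
open import Data.Empty using (⊥-elim)
open import Data.Fin using (Fin; zero; suc; toℕ; inject₁; fromℕ; fromℕ<; opposite)
open import Data.Fin.Induction using (<-weakInduction)
open import Data.Fin.Patterns using (0F; 1F; 2F; 3F)
open import Data.Fin.Permutation using (Permutation′; _⟨$⟩ʳ_; _∘ₚ_; reverse; transpose)
open import Data.Fin.Properties
  using (toℕ-injective; toℕ-inject₁; toℕ-fromℕ; toℕ-fromℕ<; toℕ≤pred[n];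
         opposite-prop; opposite-involutive; all?)
open import Data.List using (List; []; _∷_; length; filter; upTo; tabulate)
open import Data.List.Membership.Propositional using (_∈_; _∉_)
open import Data.List.Membership.Propositional.Properties using (∈-filter⁺; ∈-upTo⁻; ∈-tabulate⁺)
open import Data.List.Properties using (filter-notAll; length-upTo; length-tabulate)
open import Data.List.Relation.Unary.All as All using ()
open import Data.List.Relation.Unary.Any as Any using (here; there)
open import Data.List.Relation.Unary.AllPairs using (_∷_)
open import Data.List.Relation.Unary.Unique.Propositional using (Unique)
open import Data.List.Relation.Unary.Unique.Propositional.Properties using (upTo⁺)
open import Data.Nat using (ℕ; zero; suc; _+_; _*_; _∸_; _≤_; _<_; _≥_; _≟_; z≤n; s≤s; s≤s⁻¹)
open import Data.List.Membership.DecPropositional _≟_ using (_∈?_)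
open import Data.Nat.Properties
  using (≤-refl; ≤-trans; <-≤-trans; n≤0⇒n≡0; +-identityʳ; +-suc; +-comm; +-cancelʳ-≡; +-cancelʳ-≤;
         m≤m+n; m+n∸m≡n; m∸n+n≡m; m≢1+n+m; n≤1+n; n<1⇒n≡0; suc-injective; allUpTo?)
open import Data.Product using (Σ; ∃-syntax; _×_; _,_)
open import Data.Sum as Sum using (_⊎_; inj₁; inj₂)
import Data.Vec.Functional as Vector
open import Function using (_∘_; id)
open import Function.Bundles using (_⇔_; mk⇔; module Equivalence; module Injection)
open import Function.Construct.Composition using (_⇔-∘_)
open import Function.Definitions using (Injective)
open import Function.Properties.Inverse using (↔⇒↣)
open import Relation.Binary using (Decidable)
open import Relation.Binary.PropositionalEquality
  using (_≡_; _≢_; refl; sym; trans; cong; subst; subst₂; ≢-sym; module ≡-Reasoning)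
open import Relation.Nullary using (Dec; ¬_; ¬?; yes; no)
open import Relation.Nullary.Decidable using (map′; _⊎-dec_; _×-dec_; _→-dec_; from-yes)
open import Relation.Unary using (Pred)

open ≡-Reasoning

pick-avoiding : ∀ {l : List ℕ} (avoid : List ℕ) → Unique l → length avoid < length l →
                ∃[ c ] c ∈ l × c ∉ avoid
pick-avoiding {[]} _ _ ()
pick-avoiding {x ∷ xs} avoid (x∉xs ∷ xs-unique) lt with x ∈? avoid
... | no x∉avoid = x , here refl , x∉avoid
... | yes x∈avoid
  with c , c∈xs , c∉avoid′ ← pick-avoiding (filter (λ c → ¬? (c ≟ x)) avoid) xs-unique
         (≤-trans (filter-notAll _ avoid (Any.map (λ c≡x c≢x → c≢x (sym c≡x)) x∈avoid)) (s≤s⁻¹ lt))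
  = c , there c∈xs , λ c∈avoid → c∉avoid′ (∈-filter⁺ _ c∈avoid λ c≡x → All.lookup x∉xs c∈xs (sym c≡x))

choose-avoiding : ∀ {n k} {L : ListAssignment n} → HasListSize L k →
                  ∀ v (avoid : List ℕ) → length avoid < k → ∃[ c ] c ∈ L v × c ∉ avoid
choose-avoiding size v avoid lt with size v
... | unique , refl = pick-avoiding avoid unique lt

distinct-list-coloring : ∀ {n k} (L : ListAssignment n) → HasListSize L k → n ≤ k →
                         Σ (Coloring n) λ f → Injective _≡_ _≡_ f × (∀ v → f v ∈ L v)
distinct-list-coloring {zero} L size _ = (λ ()) , (λ { {()} }) , λ ()
distinct-list-coloring {suc n} {k} L size n<k
  with f , f-injective , f∈ ← distinct-list-coloring (L ∘ suc) (size ∘ suc) (≤-trans (n≤1+n n) n<k)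
  with c , c∈ , c∉ ← choose-avoiding size zero (tabulate f) (subst (_< k) (sym (length-tabulate f)) n<k)
  = c Vector.∷ f , injective , λ { zero → c∈ ; (suc v) → f∈ v }
  where
  injective : ∀ {u v} → (c Vector.∷ f) u ≡ (c Vector.∷ f) v → u ≡ v
  injective {zero}  {zero}  _ = refl
  injective {zero}  {suc v} e = ⊥-elim (c∉ (subst (_∈ tabulate f) (sym e) (∈-tabulate⁺ v)))
  injective {suc u} {zero}  e = ⊥-elim (c∉ (subst (_∈ tabulate f) e (∈-tabulate⁺ u)))
  injective {suc u} {suc v} e = cong suc (f-injective e)

injective⇒proper : ∀ {n} (G : Graph n) {f : Coloring n} → Injective _≡_ _≡_ f → Proper G f
injective⇒proper G f-injective u v adj fu≡fv = adj-irrefl G (subst (Adj G u) (sym (f-injective fu≡fv)) adj)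

injective⇒distinguishing : ∀ {n} (G : Graph n) {f : Coloring n} → Injective _≡_ _≡_ f →
                           Distinguishing G f
injective⇒distinguishing G f-injective φ _ preserves v = f-injective (preserves v)

listDistChoosable-order : ∀ {n} (G : Graph n) → ListDistChoosable G n
listDistChoosable-order G L size with f , f-injective , f∈ ← distinct-list-coloring L size ≤-refl
  = f , injective⇒proper G f-injective , injective⇒distinguishing G f-injective , f∈

χD≤ : ∀ {n} → Graph n → ℕ → Set
χD≤ {n} G k = Σ (Coloring n) λ f → Proper G f × Distinguishing G f × (∀ v → f v < k)

listDistChoosable⇒χD≤ : ∀ {n} {G : Graph n} {k} → ListDistChoosable G k → χD≤ G k
listDistChoosable⇒χD≤ {k = k} choosable
  with f , proper , distinguishing , f∈ ← choosable (λ _ → upTo k) (λ _ → upTo⁺ k , length-upTo k)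
  = f , proper , distinguishing , ∈-upTo⁻ ∘ f∈

χD≤-mono : ∀ {n} {G : Graph n} {j k} → j ≤ k → χD≤ G j → χD≤ G k
χD≤-mono j≤k (f , proper , distinguishing , f<j) = f , proper , distinguishing , λ v → <-≤-trans (f<j v) j≤k

χDL≡-intro : ∀ {n} {G : Graph n} {k} → ListDistChoosable G (suc k) → ¬ χD≤ G k → χDL≡ G (suc k)
χDL≡-intro {G = G} choosable ¬χD≤k =
  choosable , λ j j<1+k choosable-j →
    ¬χD≤k (χD≤-mono {G = G} (s≤s⁻¹ j<1+k) (listDistChoosable⇒χD≤ {G = G} choosable-j))

adjacent⇒¬χD≤1 : ∀ {n} {G : Graph n} {u v} → Adj G u v → ¬ χD≤ G 1
adjacent⇒¬χD≤1 {u = u} {v} adj (f , proper , _ , f<1) =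
  proper u v adj (trans (n<1⇒n≡0 (f<1 u)) (sym (n<1⇒n≡0 (f<1 v))))

P-edge : ∀ {m} (i : Fin m) → PathAdj (inject₁ i) (suc i)
P-edge i = inj₁ (cong suc (sym (toℕ-inject₁ i)))

toℕ-opposite+toℕ : ∀ {m} (i : Fin (suc m)) → toℕ (opposite i) + toℕ i ≡ m
toℕ-opposite+toℕ i = trans (cong (_+ toℕ i) (opposite-prop i)) (m∸n+n≡m (toℕ≤pred[n] i))

opposite-step : ∀ {m} {u v : Fin (suc m)} → toℕ v ≡ suc (toℕ u) → toℕ (opposite u) ≡ suc (toℕ (opposite v))
opposite-step {u = u} {v} v≡1+u = +-cancelʳ-≡ (toℕ u) _ _ (begin
  toℕ (opposite u) + toℕ u        ≡⟨ toℕ-opposite+toℕ u ⟩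
  _                               ≡⟨ toℕ-opposite+toℕ v ⟨
  toℕ (opposite v) + toℕ v        ≡⟨ cong (toℕ (opposite v) +_) v≡1+u ⟩
  toℕ (opposite v) + suc (toℕ u)  ≡⟨ +-suc _ _ ⟩
  suc (toℕ (opposite v)) + toℕ u  ∎)

opposite-PathAdj : ∀ {m} {u v : Fin (suc m)} → PathAdj u v → PathAdj (opposite u) (opposite v)
opposite-PathAdj = Sum.swap ∘ Sum.map opposite-step opposite-step

reverse-isAutomorphism : ∀ {m} → IsAutomorphism (P (suc m)) reverse
reverse-isAutomorphism u v = mk⇔ opposite-PathAdj
  (subst₂ PathAdj (opposite-involutive u) (opposite-involutive v) ∘ opposite-PathAdj)

∘ₚ-isAutomorphism : ∀ {n} {G : Graph n} {φ ψ} → IsAutomorphism G φ → IsAutomorphism G ψ →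
                    IsAutomorphism G (φ ∘ₚ ψ)
∘ₚ-isAutomorphism {φ = φ} φ-aut ψ-aut u v = ψ-aut (φ ⟨$⟩ʳ u) (φ ⟨$⟩ʳ v) ⇔-∘ φ-aut u v

Ascends : ∀ {m} → Permutation′ (suc m) → Fin m → Set
Ascends φ i = toℕ (φ ⟨$⟩ʳ suc i) ≡ suc (toℕ (φ ⟨$⟩ʳ inject₁ i))

ascends-everywhere : ∀ {m} φ → IsAutomorphism (P (suc (suc m))) φ → Ascends φ zero → ∀ i → Ascends φ i
ascends-everywhere φ φ-aut ascends₀ = <-weakInduction (Ascends φ) ascends₀ step
  where
  -- Turning back at edge suc i would send suc (suc i) and inject₁ (inject₁ i) to the same vertex.
  step : ∀ i → Ascends φ (inject₁ i) → Ascends φ (suc i)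
  step i ascends with Equivalence.to (φ-aut _ _) (P-edge (suc i))
  ... | inj₁ ascends′ = ascends′
  ... | inj₂ descends = ⊥-elim (m≢1+n+m (toℕ i) {1} (begin
    toℕ i                              ≡⟨ toℕ-inject₁ i ⟨
    toℕ (inject₁ i)                    ≡⟨ toℕ-inject₁ (inject₁ i) ⟨
    toℕ (inject₁ (inject₁ i))          ≡⟨ cong toℕ (Injection.injective (↔⇒↣ φ) (toℕ-injective
                                            (suc-injective (trans (sym ascends) descends)))) ⟩
    toℕ (suc (suc i))                  ∎))

ascending⇒identity : ∀ {m} φ → (∀ i → Ascends {m} φ i) → ∀ v → φ ⟨$⟩ʳ v ≡ v
ascending⇒identity {m} φ ascends v = toℕ-injective (trans (shift v) (cong (_+ toℕ v) φ₀≡0))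
  where
  φ₀ = toℕ (φ ⟨$⟩ʳ zero)
  shift : ∀ v → toℕ (φ ⟨$⟩ʳ v) ≡ φ₀ + toℕ v
  shift = <-weakInduction (λ v → toℕ (φ ⟨$⟩ʳ v) ≡ φ₀ + toℕ v) (sym (+-identityʳ φ₀)) λ i shiftᵢ → begin
    toℕ (φ ⟨$⟩ʳ suc i)              ≡⟨ ascends i ⟩
    suc (toℕ (φ ⟨$⟩ʳ inject₁ i))    ≡⟨ cong suc shiftᵢ ⟩
    suc (φ₀ + toℕ (inject₁ i))      ≡⟨ cong (λ n → suc (φ₀ + n)) (toℕ-inject₁ i) ⟩
    suc (φ₀ + toℕ i)                ≡⟨ +-suc φ₀ (toℕ i) ⟨
    φ₀ + suc (toℕ i)                ∎
  φ₀≡0 : φ₀ ≡ 0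
  φ₀≡0 = n≤0⇒n≡0 (+-cancelʳ-≤ m φ₀ 0
    (subst (_≤ m) (trans (shift (fromℕ m)) (cong (φ₀ +_) (toℕ-fromℕ m))) (toℕ≤pred[n] (φ ⟨$⟩ʳ fromℕ m))))

P-automorphism : ∀ {m} φ → IsAutomorphism (P (suc m)) φ →
                 (∀ v → φ ⟨$⟩ʳ v ≡ v) ⊎ (∀ v → φ ⟨$⟩ʳ v ≡ opposite v)
P-automorphism {zero} φ _ = inj₁ (ascending⇒identity φ λ ())
P-automorphism {suc m} φ φ-aut with Equivalence.to (φ-aut 0F 1F) (P-edge {suc m} zero)
... | inj₁ ascends₀ = inj₁ (ascending⇒identity φ (ascends-everywhere φ φ-aut ascends₀))
... | inj₂ descends₀ = inj₂ λ v → begin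
    φ ⟨$⟩ʳ v                       ≡⟨ opposite-involutive (φ ⟨$⟩ʳ v) ⟨
    opposite (opposite (φ ⟨$⟩ʳ v))  ≡⟨ cong opposite (ascending⇒identity ψ (ascends-everywhere ψ ψ-aut
                                         (opposite-step descends₀)) v) ⟩
    opposite v                      ∎
  where
  ψ = φ ∘ₚ reverse
  ψ-aut : IsAutomorphism (P (suc (suc m))) ψ
  ψ-aut = ∘ₚ-isAutomorphism {G = P (suc (suc m))} {φ = φ} {reverse} φ-aut reverse-isAutomorphism

Palindromic : ∀ {n} → Coloring n → Set
Palindromic f = ∀ v → f (opposite v) ≡ f v

¬palindromic⇒distinguishing : ∀ {m} {f : Coloring (suc m)} → ¬ Palindromic f → Distinguishing (P (suc m)) f
¬palindromic⇒distinguishing {f = f} ¬palindromic φ φ-aut preserves with P-automorphism φ φ-aut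
... | inj₁ φ≗id      = φ≗id
... | inj₂ φ≗reverse = ⊥-elim (¬palindromic λ v → subst (λ w → f w ≡ f v) (φ≗reverse v) (preserves v))

palindromic⇒¬distinguishing : ∀ {m} {f : Coloring (suc (suc m))} → Palindromic f →
                              ¬ Distinguishing (P (suc (suc m))) f
palindromic⇒¬distinguishing palindromic distinguishing
  with () ← distinguishing reverse reverse-isAutomorphism palindromic 0F

P-connected : ∀ {m ℓ} (Q : Pred (Fin (suc m)) ℓ) → (∀ i → Q (inject₁ i) ⇔ Q (suc i)) →
              ∀ {u} → Q u → ∀ v → Q v
P-connected Q across {u} Qu = <-weakInduction Q (backwards u Qu) (λ i → Equivalence.to (across i))
  where
  backwards : ∀ u → Q u → Q zero
  backwards = <-weakInduction (λ u → Q u → Q zero) id (λ i back → back ∘ Equivalence.from (across i))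

≢-≢⇒≡-binary : ∀ {x y z} → x < 2 → y < 2 → z < 2 → x ≢ y → y ≢ z → x ≡ z
≢-≢⇒≡-binary {0} {0} _ _ _ x≢y _   = ⊥-elim (x≢y refl)
≢-≢⇒≡-binary {1} {1} _ _ _ x≢y _   = ⊥-elim (x≢y refl)
≢-≢⇒≡-binary {_} {0} {0} _ _ _ _ y≢z = ⊥-elim (y≢z refl)
≢-≢⇒≡-binary {_} {1} {1} _ _ _ _ y≢z = ⊥-elim (y≢z refl)
≢-≢⇒≡-binary {0} {1} {0} _ _ _ _ _ = refl
≢-≢⇒≡-binary {1} {0} {1} _ _ _ _ _ = refl
≢-≢⇒≡-binary {suc (suc _)} (s≤s (s≤s ())) _ _ _ _
≢-≢⇒≡-binary {_} {suc (suc _)} _ (s≤s (s≤s ())) _ _ _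
≢-≢⇒≡-binary {_} {_} {suc (suc _)} _ _ (s≤s (s≤s ())) _ _

proper-∘-automorphism : ∀ {n} {G : Graph n} {f φ} → IsAutomorphism G φ → Proper G f →
                        Proper G (f ∘ (φ ⟨$⟩ʳ_))
proper-∘-automorphism φ-aut proper u v adj = proper _ _ (Equivalence.to (φ-aut u v) adj)

P-proper-2-colorings-agree : ∀ {m} {f g : Coloring (suc m)} → Proper (P (suc m)) f → Proper (P (suc m)) g →
                             (∀ v → f v < 2) → (∀ v → g v < 2) → ∀ {u} → f u ≡ g u → ∀ v → f v ≡ g v
P-proper-2-colorings-agree {f = f} {g} f-proper g-proper f<2 g<2 =
  P-connected (λ v → f v ≡ g v) λ i → mk⇔ (forwards i) (backwards i)
  where
  forwards : ∀ i → f (inject₁ i) ≡ g (inject₁ i) → f (suc i) ≡ g (suc i)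
  forwards i agree = ≢-≢⇒≡-binary (f<2 _) (g<2 _) (g<2 _)
    (λ e → f-proper _ _ (P-edge i) (trans agree (sym e))) (g-proper _ _ (P-edge i))
  backwards : ∀ i → f (suc i) ≡ g (suc i) → f (inject₁ i) ≡ g (inject₁ i)
  backwards i agree = ≢-≢⇒≡-binary (f<2 _) (g<2 _) (g<2 _)
    (λ e → f-proper _ _ (P-edge i) (trans e (sym agree))) (≢-sym (g-proper _ _ (P-edge i)))

odd-P-centre : ∀ t → Σ (Fin (suc (2 * t))) λ u → opposite u ≡ u
odd-P-centre t = u , toℕ-injective (begin
  toℕ (opposite u)          ≡⟨ opposite-prop u ⟩
  2 * t ∸ toℕ u             ≡⟨ cong (2 * t ∸_) toℕ-u ⟩
  t + (t + 0) ∸ t           ≡⟨ m+n∸m≡n t (t + 0) ⟩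
  t + 0                     ≡⟨ +-identityʳ t ⟩
  t                         ≡⟨ toℕ-u ⟨
  toℕ u                     ∎)
  where
  u = fromℕ< (s≤s (m≤m+n t (t + 0)))
  toℕ-u = toℕ-fromℕ< (s≤s (m≤m+n t (t + 0)))

odd-P-proper-2-coloring-palindromic : ∀ t {f : Coloring (suc (2 * t))} → Proper (P (suc (2 * t))) f →
                                      (∀ v → f v < 2) → Palindromic f
odd-P-proper-2-coloring-palindromic t {f} proper f<2 with _ , centre-fixed ← odd-P-centre t =
  P-proper-2-colorings-agree
    (proper-∘-automorphism {G = P _} {f} {reverse} reverse-isAutomorphism proper) proper
    (f<2 ∘ opposite) f<2 (cong f centre-fixed)

∷-proper : ∀ {m c} {f : Coloring (suc m)} → Proper (P (suc m)) f → c ≢ f zero →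
           Proper (P (suc (suc m))) (c Vector.∷ f)
∷-proper {m} {c} {f} proper c≢f₀ = cons-proper
  where
  from-head : ∀ v → PathAdj {suc (suc m)} zero v → c ≢ (c Vector.∷ f) v
  from-head zero          adj      = ⊥-elim (PathAdj-irrefl {suc (suc m)} adj)
  from-head (suc zero)    _        = c≢f₀
  from-head (suc (suc _)) (inj₁ ())
  from-head (suc (suc _)) (inj₂ ())
  cons-proper : Proper (P (suc (suc m))) (c Vector.∷ f)
  cons-proper zero    v       adj = from-head v adj
  cons-proper (suc u) zero    adj = ≢-sym (from-head (suc u) (PathAdj-sym adj))
  cons-proper (suc u) (suc v) adj = proper u v (Sum.map suc-injective suc-injective adj)

P-list-coloring : ∀ {m k} (L : ListAssignment (suc m)) → HasListSize L k → 2 ≤ k →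
                  Σ (Coloring (suc m)) λ f → Proper (P (suc m)) f × (∀ v → f v ∈ L v)
P-list-coloring {zero} L size 2≤k with c , c∈ , _ ← choose-avoiding size zero [] (≤-trans (s≤s z≤n) 2≤k) =
  (λ _ → c) , (λ { zero zero adj → ⊥-elim (PathAdj-irrefl {1} adj) }) , λ { zero → c∈ }
P-list-coloring {suc m} L size 2≤k
  with f , proper , f∈ ← P-list-coloring (L ∘ suc) (size ∘ suc) 2≤k
  with c , c∈ , c∉ ← choose-avoiding size zero (f zero ∷ []) 2≤k
  = c Vector.∷ f , ∷-proper proper (c∉ ∘ here) , λ { zero → c∈ ; (suc v) → f∈ v }

P-listDistChoosable-3 : ∀ m → ListDistChoosable (P (suc (suc m))) 3
P-listDistChoosable-3 m L size
  with f , proper , f∈ ← P-list-coloring (L ∘ suc) (size ∘ suc) (s≤s (s≤s z≤n))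
  with c , c∈ , c∉ ← choose-avoiding size zero (f zero ∷ f (fromℕ m) ∷ []) ≤-refl
  = c Vector.∷ f , ∷-proper proper (c∉ ∘ here)
  , ¬palindromic⇒distinguishing (λ palindromic → c∉ (there (here (sym (palindromic zero)))))
  , λ { zero → c∈ ; (suc v) → f∈ v }

even-P-middle-edge : ∀ t → Σ (Fin (2 * suc t)) λ u → PathAdj u (opposite u)
even-P-middle-edge t = u , inj₁ (begin
  toℕ (opposite u)              ≡⟨ opposite-prop u ⟩
  2 * suc t ∸ suc (toℕ u)       ≡⟨ cong (λ i → 2 * suc t ∸ suc i) toℕ-u ⟩
  suc t + (suc t + 0) ∸ suc t   ≡⟨ m+n∸m≡n (suc t) (suc t + 0) ⟩
  suc t + 0                     ≡⟨ +-identityʳ (suc t) ⟩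
  suc t                         ≡⟨ cong suc toℕ-u ⟨
  suc (toℕ u)                   ∎)
  where
  u = fromℕ< (m≤m+n (suc t) (suc t + 0))
  toℕ-u = toℕ-fromℕ< (m≤m+n (suc t) (suc t + 0))

even-P-χDL : ∀ t → χDL≡ (P (2 * suc t)) 2
even-P-χDL t with u , middle-edge ← even-P-middle-edge t =
  χDL≡-intro {G = P (2 * suc t)} choosable (adjacent⇒¬χD≤1 {G = P (2 * suc t)} middle-edge)
  where
  choosable : ListDistChoosable (P (2 * suc t)) 2
  choosable L size with f , proper , f∈ ← P-list-coloring L size ≤-refl =
    f , proper
    , ¬palindromic⇒distinguishing (λ palindromic → proper _ _ middle-edge (sym (palindromic u)))
    , f∈

odd-P-χDL : ∀ t → χDL≡ (P (suc (2 * suc t))) 3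
odd-P-χDL t = χDL≡-intro {G = P (suc (2 * suc t))} (P-listDistChoosable-3 _)
  λ (f , proper , distinguishing , f<2) →
    palindromic⇒¬distinguishing (odd-P-proper-2-coloring-palindromic (suc t) proper f<2) distinguishing

_⇔-dec_ : ∀ {a b} {A : Set a} {B : Set b} → Dec A → Dec B → Dec (A ⇔ B)
a? ⇔-dec b? = map′ (λ (to , from) → mk⇔ to from) (λ A⇔B → Equivalence.to A⇔B , Equivalence.from A⇔B)
  ((a? →-dec b?) ×-dec (b? →-dec a?))

PathAdj? : ∀ {n} → Decidable (PathAdj {n})
PathAdj? u v = (toℕ v ≟ suc (toℕ u)) ⊎-dec (toℕ u ≟ suc (toℕ v))

CycleAdj? : ∀ n → Decidable (CycleAdj n)
CycleAdj? n u v =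
  PathAdj? u v ⊎-dec ((toℕ u ≟ 0) ×-dec (toℕ v ≟ n ∸ 1)) ⊎-dec ((toℕ v ≟ 0) ×-dec (toℕ u ≟ n ∸ 1))

isAutomorphism? : ∀ {n} (G : Graph n) → Decidable (Adj G) → (φ : Permutation′ n) → Dec (IsAutomorphism G φ)
isAutomorphism? G adj? φ = all? λ u → all? λ v → adj? u v ⇔-dec adj? (φ ⟨$⟩ʳ u) (φ ⟨$⟩ʳ v)

C4-reflection₀₂ : IsAutomorphism C4 (transpose 0F 2F)
C4-reflection₀₂ = from-yes (isAutomorphism? C4 (CycleAdj? 4) (transpose 0F 2F))

C4-reflection₁₃ : IsAutomorphism C4 (transpose 1F 3F)
C4-reflection₁₃ = from-yes (isAutomorphism? C4 (CycleAdj? 4) (transpose 1F 3F))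

C4-3-coloring-antipodes-collide : ∀ {a} → a < 3 → ∀ {b} → b < 3 → ∀ {c} → c < 3 → ∀ {d} → d < 3 →
                                  a ≢ b → b ≢ c → c ≢ d → d ≢ a → a ≡ c ⊎ b ≡ d
C4-3-coloring-antipodes-collide = from-yes
  (allUpTo? (λ a → allUpTo? (λ b → allUpTo? (λ c → allUpTo? (λ d →
    ¬? (a ≟ b) →-dec ¬? (b ≟ c) →-dec ¬? (c ≟ d) →-dec ¬? (d ≟ a) →-dec (a ≟ c ⊎-dec b ≟ d)) 3) 3) 3) 3)

C4-¬χD≤3 : ¬ χD≤ C4 3
C4-¬χD≤3 (f , proper , distinguishing , f<3)
  with C4-3-coloring-antipodes-collide (f<3 0F) (f<3 1F) (f<3 2F) (f<3 3F)
         (proper 0F 1F (inj₁ (inj₁ refl))) (proper 1F 2F (inj₁ (inj₁ refl)))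
         (proper 2F 3F (inj₁ (inj₁ refl))) (proper 3F 0F (inj₂ (inj₂ (refl , refl))))
... | inj₁ f₀≡f₂ with () ← distinguishing (transpose 0F 2F) C4-reflection₀₂
                            (λ { 0F → sym f₀≡f₂ ; 1F → refl ; 2F → f₀≡f₂ ; 3F → refl }) 0F
... | inj₂ f₁≡f₃ with () ← distinguishing (transpose 1F 3F) C4-reflection₁₃
                            (λ { 0F → refl ; 1F → sym f₁≡f₃ ; 2F → refl ; 3F → f₁≡f₃ }) 1F

proposition2p2 : (∀ (t : ℕ) → t ≥ 1 → χDL≡ (P (2 * t)) 2 × χDL≡ (P (2 * t + 1)) 3)
    × χDL≡ C4 4
proposition2p2 =
  (λ { zero ()
     ; (suc t) _ → even-P-χDL t , subst (λ n → χDL≡ (P n) 3) (+-comm 1 (2 * suc t)) (odd-P-χDL t) })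
  , χDL≡-intro {G = C4} (listDistChoosable-order C4) C4-¬χD≤3
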